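{- Let $t$ be a term such that $t$ reduces by finitely many $\rhd\mathsf{shuf}$-steps to a value $v$. Then for every derivation $\pi$ with conclusion $\vdash t \colon \mathbf{0}$ (empty environment) and every reduction sequence $d$ from $t$ to its $\rhd\mathsf{shuf}$-normal form by $\rhd\mathsf{shuf}$-steps, the number of $\rhd\beta_v$-steps in $d$ equals $|\pi|$.
   Context: Terms: $t ::= x \mid \lambda x.t \mid tu$ (up to $\alpha$); values $v ::= x \mid \lambda x.t$; $\mathrm{Fv}(t)$ free variables; $t\{v/x\}$ substitution. Root steps: ($\beta_v$) $(\lambda x.t)v \mapsto t\{v/x\}$, $v$ a value; ($\sigma_1$) $(\lambda x.t)us \mapsto (\lambda x.ts)u$ if $x\notin\mathrm{Fv}(s)$; ($\sigma_3$) $v((\lambda x.s)u)\mapsto(\lambda x.vs)u$ if $v$ a value, $x\notin\mathrm{Fv}(v)$. Balanced contexts $B ::= [\cdot] \mid (\lambda x.B)t \mid Bt \mid tB$; $\rhd r$-reduction is the closure of root step $r$ under balanced contexts; $\rhd\mathsf{shuf}$ is the union of $\rhd\beta_v,\rhd\sigma_1,\rhd\sigma_3$ (it is confluent, so normal forms are unique). Types: positive types are finite multisets $[(P_1,Q_1),\dots,(P_n,Q_n)]$ of pairs of positive types ($\mathbf{0}$ empty, $\uplus$ union). Environments map variables to positive types (finitely many non-$\mathbf{0}$), combined pointwise by $\uplus$; an empty environment assigns $\mathbf{0}$ to all variables. Rules: (ax) $x\colon P\vdash x\colon P$; ($\lambda$) from $\Gamma_i,x\colon P_i\vdash t\colon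 Q_i$ ($1\le i\le n$, $n\ge0$) infer $\biguplus_i\Gamma_i\vdash\lambda x.t\colon[(P_1,Q_1),\dots,(P_n,Q_n)]$; ($@$) from $\Gamma\vdash t\colon[(P,Q)]$ and $\Delta\vdash u\colon P$ infer $\Gamma\uplus\Delta\vdash tu\colon Q$. The size $|\pi|$ of a derivation is the number of $@$ rules in it. -}

module Defs where

open import Data.Nat using (ℕ; zero; suc; _+_; _<ᵇ_; _≡ᵇ_)
open import Data.Bool using (if_then_else_)
open import Data.List using (List; []; _∷_)
open import Data.Product using (_×_; _,_; ∃)
open import Relation.Nullary using (¬_)

-- Terms of the untyped λ-calculus, de Bruijn indices (terms up to α)

data Term : Set where
  var : ℕ → Term
  lam : Term → Term
  app : Term → Term → Term

data IsValue : Term → Set where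
  var-val : ∀ x → IsValue (var x)
  lam-val : ∀ t → IsValue (lam t)

shift : ℕ → Term → Term
shift c (var x) = if x <ᵇ c then var x else var (suc x)
shift c (lam t) = lam (shift (suc c) t)
shift c (app t u) = app (shift c t) (shift c u)

subst : ℕ → Term → Term → Term
subst j v (var x) =
  if x ≡ᵇ j then v else (if x <ᵇ j then var x else var (pred x))
  where pred : ℕ → ℕ
        pred zero = zero
        pred (suc n) = n
subst j v (lam t) = lam (subst (suc j) (shift 0 v) t)
subst j v (app t u) = app (subst j v t) (subst j v u)

_[_] : Term → Term → Term
t [ v ] = subst 0 v t

-- Root steps.  In de Bruijn form the side conditions x ∉ Fv(s), x ∉ Fv(v)
-- are the (automatic) freshness of the bound variable, realised by shifting.

data Rule : Set where
  βv σ₁ σ₃ : Rule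

data Root : Rule → Term → Term → Set where
  root-βv : ∀ t v → IsValue v → Root βv (app (lam t) v) (t [ v ])
  root-σ₁ : ∀ t u s →
    Root σ₁ (app (app (lam t) u) s) (app (lam (app t (shift 0 s))) u)
  root-σ₃ : ∀ v s u → IsValue v →
    Root σ₃ (app v (app (lam s) u)) (app (lam (app (shift 0 v) s)) u)

data Step (r : Rule) : Term → Term → Set where
  hole   : ∀ {t t'} → Root r t t' → Step r t t'
  under  : ∀ {b b'} u → Step r b b' → Step r (app (lam b) u) (app (lam b') u)
  appL   : ∀ {b b'} u → Step r b b' → Step r (app b u) (app b' u)
  appR   : ∀ {b b'} t → Step r b b' → Step r (app t b) (app t b')

_▷shuf_ : Term → Term → Set
t ▷shuf u = ∃ λ r → Step r t u

data Seq : Term → Term → Set where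
  done : ∀ t → Seq t t
  next : ∀ {t u w} (r : Rule) → Step r t u → Seq u w → Seq t w

isβv : Rule → ℕ
isβv βv = 1
isβv σ₁ = 0
isβv σ₃ = 0

βvSteps : ∀ {t u} → Seq t u → ℕ
βvSteps (done _) = 0
βvSteps (next r _ d) = isβv r + βvSteps d

Normal : Term → Set
Normal t = ∀ u → ¬ (t ▷shuf u)

-- Positive types: finite multisets of pairs of positive types.
-- Represented by lists, taken up to the multiset equivalence _≈_ below.

data Ty : Set where
  mset : List (Ty × Ty) → Ty

𝟎 : Ty
𝟎 = mset []

infixr 5 _⊎ᵗ_
_⊎ᵗ_ : Ty → Ty → Ty
mset xs ⊎ᵗ mset ys = mset (app' xs ys)
  where app' : List (Ty × Ty) → List (Ty × Ty) → List (Ty × Ty)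
        app' [] l = l
        app' (x ∷ k) l = x ∷ app' k l

mutual
  data _≈_ : Ty → Ty → Set where
    mset≈ : ∀ {l l'} → l ~ l' → mset l ≈ mset l'

  data _~_ : List (Ty × Ty) → List (Ty × Ty) → Set where
    nil   : [] ~ []
    cons  : ∀ {P P' Q Q' l l'} → P ≈ P' → Q ≈ Q' → l ~ l' →
            ((P , Q) ∷ l) ~ ((P' , Q') ∷ l')
    swap  : ∀ {x y l} → (x ∷ y ∷ l) ~ (y ∷ x ∷ l)
    trans : ∀ {l m n} → l ~ m → m ~ n → l ~ n

Env : Set
Env = ℕ → Ty

emptyEnv : Env
emptyEnv _ = 𝟎

_⊎ᵉ_ : Env → Env → Env
(Γ ⊎ᵉ Δ) x = Γ x ⊎ᵗ Δ x

_≈ᵉ_ : Env → Env → Set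
Γ ≈ᵉ Δ = ∀ x → Γ x ≈ Δ x

single : ℕ → Ty → Env
single x P y = if y ≡ᵇ x then P else 𝟎

_,,_ : Env → Ty → Env
(Γ ,, P) zero = P
(Γ ,, P) (suc y) = Γ y

-- Type derivations.  'conv' only identifies types/environments that are
-- equal as multisets; it is not counted in the size.

mutual
  data _⊢_∶_ : Env → Term → Ty → Set where
    ax   : ∀ x P → single x P ⊢ var x ∶ P
    lamR : ∀ {Γ t L} → Prems t Γ L → Γ ⊢ lam t ∶ mset L
    appR : ∀ {Γ Δ t u P Q} → Γ ⊢ t ∶ mset ((P , Q) ∷ []) → Δ ⊢ u ∶ P →
           (Γ ⊎ᵉ Δ) ⊢ app t u ∶ Q
    conv : ∀ {Γ Γ' t P P'} → Γ ≈ᵉ Γ' → P ≈ P' → Γ ⊢ t ∶ P → Γ' ⊢ t ∶ P'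

  data Prems (t : Term) : Env → List (Ty × Ty) → Set where
    []  : Prems t emptyEnv []
    _∷_ : ∀ {Γ Δ P Q L} → (Γ ,, P) ⊢ t ∶ Q → Prems t Δ L →
          Prems t (Γ ⊎ᵉ Δ) ((P , Q) ∷ L)

mutual
  size : ∀ {Γ t P} → Γ ⊢ t ∶ P → ℕ
  size (ax _ _) = 0
  size (lamR ps) = sizePs ps
  size (appR π ρ) = suc (size π + size ρ)
  size (conv _ _ π) = size π

  sizePs : ∀ {t Γ L} → Prems t Γ L → ℕ
  sizePs [] = 0
  sizePs (π ∷ ps) = size π + sizePs ps

module Submission where

-- A ▷shuf step transforms a derivation of t into one of its reduct, with the same environment
-- and type.  For a βv step this is a substitution lemma: the derivation of the value is split
-- among the occurrences of the variable, so sizes add up and exactly the @ rule of the redex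
-- disappears.  σ₁ and σ₃ steps merely rearrange @ rules.  Hence along d the βv steps number
-- size π − size π', where π' types the normal form with 𝟎 in the empty environment.  That
-- normal form is a value (a head variable would need a non-empty environment, and a λ-headed
-- application would be a βv redex), so π' is an axiom or a λ rule without premises: size 0.

open import Defs
open import Algebra.Bundles using (CommutativeMonoid)
import Algebra.Construct.Pointwise as Pointwise
import Algebra.Properties.CommutativeSemigroup as CommutativeSemigroupProperties
open import Data.Bool using (true; false; T; if_then_else_)
open import Data.Bool.Properties using (if-float)
open import Data.List using (List; []; _∷_; _++_; length)
open import Data.List.Properties using (++-assoc; ++-identityʳ; length-++)
open import Data.Nat using (ℕ; zero; suc; _+_; _<_; _≤_; _≡ᵇ_; _<ᵇ_; s≤s)
open import Data.Nat.Properties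
  using ( +-identityʳ; +-assoc; +-commutativeSemigroup; m+n≡0⇒m≡0; 1+n≢0
        ; <-cmp; <⇒≢; >⇒≢; ≤⇒≯; m≤n⇒m≤1+n; ≡ᵇ⇒≡; ≡⇒≡ᵇ; <ᵇ⇒<; <⇒<ᵇ )
open import Data.Nat.Tactic.RingSolver using (solve-∀)
open import Data.Product using (Σ-syntax; _×_; _,_; proj₁; proj₂)
open import Data.Empty using (⊥-elim)
open import Function using (_∘_)
open import Level using (0ℓ)
open import Relation.Nullary using (¬_; contradiction)
open import Relation.Binary using (tri<; tri≈; tri>)
open import Relation.Binary.PropositionalEquality as ≡ using (_≡_; _≢_; refl; cong; cong₂)
open ≡.≡-Reasoning

mutual
  ≈-refl : ∀ {P} → P ≈ P
  ≈-refl {mset _} = mset≈ ~-refl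

  ~-refl : ∀ {l} → l ~ l
  ~-refl {[]} = nil
  ~-refl {(_ , _) ∷ _} = cons ≈-refl ≈-refl ~-refl

mutual
  ≈-sym : ∀ {P P'} → P ≈ P' → P' ≈ P
  ≈-sym (mset≈ l~l') = mset≈ (~-sym l~l')

  ~-sym : ∀ {l l'} → l ~ l' → l' ~ l
  ~-sym nil = nil
  ~-sym (cons P≈P' Q≈Q' l~l') = cons (≈-sym P≈P') (≈-sym Q≈Q') (~-sym l~l')
  ~-sym swap = swap
  ~-sym (trans l~m m~n) = trans (~-sym m~n) (~-sym l~m)

≈-trans : ∀ {P Q R} → P ≈ Q → Q ≈ R → P ≈ R
≈-trans (mset≈ l~m) (mset≈ m~n) = mset≈ (trans l~m m~n)

≈-reflexive : ∀ {P Q} → P ≡ Q → P ≈ Q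
≈-reflexive refl = ≈-refl

~-reflexive : ∀ {l l'} → l ≡ l' → l ~ l'
~-reflexive refl = ~-refl

~-++ˡ : ∀ l {m m'} → m ~ m' → (l ++ m) ~ (l ++ m')
~-++ˡ [] m~m' = m~m'
~-++ˡ ((_ , _) ∷ l) m~m' = cons ≈-refl ≈-refl (~-++ˡ l m~m')

~-++ : ∀ {l l' m m'} → l ~ l' → m ~ m' → (l ++ m) ~ (l' ++ m')
~-++ nil m~m' = m~m'
~-++ (cons P≈P' Q≈Q' l~l') m~m' = cons P≈P' Q≈Q' (~-++ l~l' m~m')
~-++ {l = x ∷ y ∷ l} swap m~m' = trans swap (~-++ˡ (y ∷ x ∷ l) m~m')
~-++ (trans l~l' l'~l'') m~m' = trans (~-++ l~l' m~m') (~-++ l'~l'' ~-refl)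

~-shift : ∀ x l m → (x ∷ l ++ m) ~ (l ++ x ∷ m)
~-shift _ [] _ = ~-refl
~-shift x (y ∷ l) m = trans swap (cons ≈-refl ≈-refl (~-shift x l m))

~-++-comm : ∀ l m → (l ++ m) ~ (m ++ l)
~-++-comm [] m = ~-reflexive (≡.sym (++-identityʳ m))
~-++-comm ((P , Q) ∷ l) m = trans (cons ≈-refl ≈-refl (~-++-comm l m)) (~-shift (P , Q) m l)

~-length : ∀ {l l'} → l ~ l' → length l ≡ length l'
~-length nil = refl
~-length (cons _ _ l~l') = cong suc (~-length l~l')
~-length swap = refl
~-length (trans l~m m~n) = ≡.trans (~-length l~m) (~-length m~n)

~-[]-inv : ∀ {l} → l ~ [] → l ≡ []
~-[]-inv {[]} _ = refl
~-[]-inv {_ ∷ _} l~[] with ~-length l~[]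
... | ()

~-[-]-inv : ∀ {l m P Q} → l ~ m → m ≡ (P , Q) ∷ [] →
            Σ[ P' ∈ Ty ] Σ[ Q' ∈ Ty ] (l ≡ (P' , Q') ∷ []) × (P' ≈ P) × (Q' ≈ Q)
~-[-]-inv (cons {P} {_} {Q} P≈ Q≈ l~[]) refl with ~-[]-inv l~[]
... | refl = P , Q , refl , P≈ , Q≈
~-[-]-inv (trans l~m m~n) refl with ~-[-]-inv m~n refl
... | _ , _ , refl , P'≈ , Q'≈ with ~-[-]-inv l~m refl
...   | P'' , Q'' , refl , P''≈ , Q''≈ = P'' , Q'' , refl , ≈-trans P''≈ P'≈ , ≈-trans Q''≈ Q'≈

elements : Ty → List (Ty × Ty)
elements (mset l) = l

⊎ᵗ-mset : ∀ l m → mset l ⊎ᵗ mset m ≡ mset (l ++ m)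
⊎ᵗ-mset [] m = refl
⊎ᵗ-mset (x ∷ l) m = cong (λ P → mset (x ∷ elements P)) (⊎ᵗ-mset l m)

⊎ᵗ-cong : ∀ {A A' B B'} → A ≈ A' → B ≈ B' → (A ⊎ᵗ B) ≈ (A' ⊎ᵗ B')
⊎ᵗ-cong {mset l} {mset l'} {mset m} {mset m'} (mset≈ l~l') (mset≈ m~m')
  rewrite ⊎ᵗ-mset l m | ⊎ᵗ-mset l' m' = mset≈ (~-++ l~l' m~m')

⊎ᵗ-comm : ∀ A B → (A ⊎ᵗ B) ≈ (B ⊎ᵗ A)
⊎ᵗ-comm (mset l) (mset m) rewrite ⊎ᵗ-mset l m | ⊎ᵗ-mset m l = mset≈ (~-++-comm l m)

⊎ᵗ-assoc : ∀ A B C → ((A ⊎ᵗ B) ⊎ᵗ C) ≈ (A ⊎ᵗ (B ⊎ᵗ C))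
⊎ᵗ-assoc (mset l) (mset m) (mset n) = ≈-reflexive (begin
  (mset l ⊎ᵗ mset m) ⊎ᵗ mset n  ≡⟨ cong (_⊎ᵗ mset n) (⊎ᵗ-mset l m) ⟩
  mset (l ++ m) ⊎ᵗ mset n       ≡⟨ ⊎ᵗ-mset (l ++ m) n ⟩
  mset ((l ++ m) ++ n)          ≡⟨ cong mset (++-assoc l m n) ⟩
  mset (l ++ (m ++ n))          ≡⟨ ⊎ᵗ-mset l (m ++ n) ⟨
  mset l ⊎ᵗ mset (m ++ n)       ≡⟨ cong (mset l ⊎ᵗ_) (⊎ᵗ-mset m n) ⟨
  mset l ⊎ᵗ (mset m ⊎ᵗ mset n)  ∎)

⊎ᵗ-identityˡ : ∀ A → (𝟎 ⊎ᵗ A) ≈ A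
⊎ᵗ-identityˡ (mset _) = ≈-refl

⊎ᵗ-identityʳ : ∀ A → (A ⊎ᵗ 𝟎) ≈ A
⊎ᵗ-identityʳ (mset l) rewrite ⊎ᵗ-mset l [] = ≈-reflexive (cong mset (++-identityʳ l))

Ty-commutativeMonoid : CommutativeMonoid 0ℓ 0ℓ
Ty-commutativeMonoid = record
  { Carrier = Ty
  ; _≈_ = _≈_
  ; _∙_ = _⊎ᵗ_
  ; ε = 𝟎
  ; isCommutativeMonoid = record
    { isMonoid = record
      { isSemigroup = record
        { isMagma = record
          { isEquivalence = record { refl = ≈-refl ; sym = ≈-sym ; trans = ≈-trans }
          ; ∙-cong = ⊎ᵗ-cong
          }
        ; assoc = ⊎ᵗ-assoc
        }
      ; identity = ⊎ᵗ-identityˡ , ⊎ᵗ-identityʳ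
      }
    ; comm = ⊎ᵗ-comm
    }
  }

card : Ty → ℕ
card (mset l) = length l

card-≈ : ∀ {A B} → A ≈ B → card A ≡ card B
card-≈ (mset≈ l~l') = ~-length l~l'

card-⊎ᵗ : ∀ A B → card (A ⊎ᵗ B) ≡ card A + card B
card-⊎ᵗ (mset l) (mset m) = ≡.trans (cong card (⊎ᵗ-mset l m)) (length-++ l)

card≡0⇒≡𝟎 : ∀ A → card A ≡ 0 → A ≡ 𝟎
card≡0⇒≡𝟎 (mset []) _ = refl

⊎ᵗ-conicalˡ : ∀ A B → (A ⊎ᵗ B) ≈ 𝟎 → A ≈ 𝟎
⊎ᵗ-conicalˡ A B A⊎B≈𝟎 =
  ≈-reflexive (card≡0⇒≡𝟎 A (m+n≡0⇒m≡0 (card A) (≡.trans (≡.sym (card-⊎ᵗ A B)) (card-≈ A⊎B≈𝟎))))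

⊎ᵗ-conicalʳ : ∀ A B → (A ⊎ᵗ B) ≈ 𝟎 → B ≈ 𝟎
⊎ᵗ-conicalʳ A B A⊎B≈𝟎 = ⊎ᵗ-conicalˡ B A (≈-trans (⊎ᵗ-comm B A) A⊎B≈𝟎)

Env-commutativeMonoid : CommutativeMonoid 0ℓ 0ℓ
Env-commutativeMonoid = Pointwise.commutativeMonoid ℕ Ty-commutativeMonoid

open CommutativeMonoid Env-commutativeMonoid using ()
  renaming ( refl to ≈ᵉ-refl; sym to ≈ᵉ-sym; trans to ≈ᵉ-trans
           ; ∙-cong to ⊎ᵉ-cong; assoc to ⊎ᵉ-assoc; identityˡ to ⊎ᵉ-identityˡ; identityʳ to ⊎ᵉ-identityʳ
           ; commutativeSemigroup to Env-commutativeSemigroup )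
module Env⊎ = CommutativeSemigroupProperties Env-commutativeSemigroup
module ℕ+ = CommutativeSemigroupProperties +-commutativeSemigroup

⊎ᵉ-conical : ∀ Γ Δ → (Γ ⊎ᵉ Δ) ≈ᵉ emptyEnv → (Γ ≈ᵉ emptyEnv) × (Δ ≈ᵉ emptyEnv)
⊎ᵉ-conical Γ Δ Γ⊎Δ≈∅ = (λ x → ⊎ᵗ-conicalˡ (Γ x) (Δ x) (Γ⊎Δ≈∅ x))
                      , (λ x → ⊎ᵗ-conicalʳ (Γ x) (Δ x) (Γ⊎Δ≈∅ x))

,,-cong : ∀ {Γ Γ' P P'} → Γ ≈ᵉ Γ' → P ≈ P' → (Γ ,, P) ≈ᵉ (Γ' ,, P')
,,-cong _ P≈P' zero = P≈P'
,,-cong Γ≈Γ' _ (suc y) = Γ≈Γ' y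

,,-⊎ᵉ : ∀ Γ Δ P Q → ((Γ ,, P) ⊎ᵉ (Δ ,, Q)) ≈ᵉ ((Γ ⊎ᵉ Δ) ,, (P ⊎ᵗ Q))
,,-⊎ᵉ _ _ _ _ zero = ≈-refl
,,-⊎ᵉ _ _ _ _ (suc _) = ≈-refl

if-true : ∀ {A : Set} {b} {x y : A} → T b → (if b then x else y) ≡ x
if-true {b = true} _ = refl

if-false : ∀ {A : Set} {b} {x y : A} → ¬ T b → (if b then x else y) ≡ y
if-false {b = false} _ = refl
if-false {b = true} ¬T = contradiction _ ¬T

single-self : ∀ x P → single x P x ≡ P
single-self x P = if-true (≡⇒≡ᵇ x x refl)

single-≢ : ∀ {x y} P → x ≢ y → single x P y ≡ 𝟎
single-≢ {x} {y} P x≢y = if-false (λ y≡ᵇx → x≢y (≡.sym (≡ᵇ⇒≡ y x y≡ᵇx)))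

single-cong : ∀ x {P P'} → P ≈ P' → single x P ≈ᵉ single x P'
single-cong x P≈P' y with y ≡ᵇ x
... | true = P≈P'
... | false = ≈-refl

single-⊎ᵗ : ∀ x A B → single x (A ⊎ᵗ B) ≈ᵉ (single x A ⊎ᵉ single x B)
single-⊎ᵗ x A B y with y ≡ᵇ x
... | true = ≈-refl
... | false = ≈-refl

single-𝟎 : ∀ x {P} → P ≈ 𝟎 → single x P ≈ᵉ emptyEnv
single-𝟎 x P≈𝟎 y with y ≡ᵇ x
... | true = P≈𝟎
... | false = ≈-refl

shiftᵉ : ℕ → Env → Env
shiftᵉ zero Γ = Γ ,, 𝟎
shiftᵉ (suc c) Γ zero = Γ zero
shiftᵉ (suc c) Γ (suc y) = shiftᵉ c (Γ ∘ suc) y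

shiftᵉ-cong : ∀ c {Γ Γ'} → Γ ≈ᵉ Γ' → shiftᵉ c Γ ≈ᵉ shiftᵉ c Γ'
shiftᵉ-cong zero Γ≈Γ' = ,,-cong Γ≈Γ' ≈-refl
shiftᵉ-cong (suc c) Γ≈Γ' zero = Γ≈Γ' zero
shiftᵉ-cong (suc c) Γ≈Γ' (suc y) = shiftᵉ-cong c (Γ≈Γ' ∘ suc) y

shiftᵉ-⊎ᵉ : ∀ c Γ Δ → shiftᵉ c (Γ ⊎ᵉ Δ) ≈ᵉ (shiftᵉ c Γ ⊎ᵉ shiftᵉ c Δ)
shiftᵉ-⊎ᵉ zero Γ Δ = ≈ᵉ-sym (,,-⊎ᵉ Γ Δ 𝟎 𝟎)
shiftᵉ-⊎ᵉ (suc c) Γ Δ zero = ≈-refl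
shiftᵉ-⊎ᵉ (suc c) Γ Δ (suc y) = shiftᵉ-⊎ᵉ c (Γ ∘ suc) (Δ ∘ suc) y

shiftᵉ-emptyEnv : ∀ c → shiftᵉ c emptyEnv ≈ᵉ emptyEnv
shiftᵉ-emptyEnv zero zero = ≈-refl
shiftᵉ-emptyEnv zero (suc y) = ≈-refl
shiftᵉ-emptyEnv (suc c) zero = ≈-refl
shiftᵉ-emptyEnv (suc c) (suc y) = shiftᵉ-emptyEnv c y

shiftᵉ-,, : ∀ c Γ P → shiftᵉ (suc c) (Γ ,, P) ≈ᵉ (shiftᵉ c Γ ,, P)
shiftᵉ-,, c Γ P zero = ≈-refl
shiftᵉ-,, c Γ P (suc y) = ≈-refl

punchIn : ℕ → ℕ → ℕ
punchIn zero x = suc x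
punchIn (suc c) zero = zero
punchIn (suc c) (suc x) = suc (punchIn c x)

shiftᵉ-single : ∀ c x P → shiftᵉ c (single x P) ≈ᵉ single (punchIn c x) P
shiftᵉ-single zero x P zero = ≈-refl
shiftᵉ-single zero x P (suc y) = ≈-refl
shiftᵉ-single (suc c) zero P zero = ≈-refl
shiftᵉ-single (suc c) zero P (suc y) = shiftᵉ-emptyEnv c y
shiftᵉ-single (suc c) (suc x) P zero = ≈-refl
shiftᵉ-single (suc c) (suc x) P (suc y) = shiftᵉ-single c x P y

shift-var : ∀ c x → shift c (var x) ≡ var (punchIn c x)
shift-var zero x = refl
shift-var (suc c) zero = refl
shift-var (suc c) (suc x) =
  ≡.trans (≡.sym (if-float (shift 0) (x <ᵇ c))) (cong (shift 0) (shift-var c x))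

dropᵉ : ℕ → Env → Env
dropᵉ zero Γ = Γ ∘ suc
dropᵉ (suc j) Γ zero = Γ zero
dropᵉ (suc j) Γ (suc y) = dropᵉ j (Γ ∘ suc) y

dropᵉ-cong : ∀ j {Γ Γ'} → Γ ≈ᵉ Γ' → dropᵉ j Γ ≈ᵉ dropᵉ j Γ'
dropᵉ-cong zero Γ≈Γ' = Γ≈Γ' ∘ suc
dropᵉ-cong (suc j) Γ≈Γ' zero = Γ≈Γ' zero
dropᵉ-cong (suc j) Γ≈Γ' (suc y) = dropᵉ-cong j (Γ≈Γ' ∘ suc) y

dropᵉ-⊎ᵉ : ∀ j Γ Δ → dropᵉ j (Γ ⊎ᵉ Δ) ≈ᵉ (dropᵉ j Γ ⊎ᵉ dropᵉ j Δ)
dropᵉ-⊎ᵉ zero Γ Δ _ = ≈-refl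
dropᵉ-⊎ᵉ (suc j) Γ Δ zero = ≈-refl
dropᵉ-⊎ᵉ (suc j) Γ Δ (suc y) = dropᵉ-⊎ᵉ j (Γ ∘ suc) (Δ ∘ suc) y

dropᵉ-emptyEnv : ∀ j → dropᵉ j emptyEnv ≈ᵉ emptyEnv
dropᵉ-emptyEnv zero _ = ≈-refl
dropᵉ-emptyEnv (suc j) zero = ≈-refl
dropᵉ-emptyEnv (suc j) (suc y) = dropᵉ-emptyEnv j y

dropᵉ-single-self : ∀ j P → dropᵉ j (single j P) ≈ᵉ emptyEnv
dropᵉ-single-self zero P _ = ≈-refl
dropᵉ-single-self (suc j) P zero = ≈-refl
dropᵉ-single-self (suc j) P (suc y) = dropᵉ-single-self j P y

dropᵉ-single-< : ∀ {x j} P → x < j → dropᵉ j (single x P) ≈ᵉ single x P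
dropᵉ-single-< {zero} {suc j} P _ zero = ≈-refl
dropᵉ-single-< {zero} {suc j} P _ (suc y) = dropᵉ-emptyEnv j y
dropᵉ-single-< {suc x} {suc j} P _ zero = ≈-refl
dropᵉ-single-< {suc x} {suc j} P (s≤s x<j) (suc y) = dropᵉ-single-< P x<j y

dropᵉ-single-> : ∀ {x j} P → j ≤ x → dropᵉ j (single (suc x) P) ≈ᵉ single x P
dropᵉ-single-> {x} {zero} P _ _ = ≈-refl
dropᵉ-single-> {suc x} {suc j} P _ zero = ≈-refl
dropᵉ-single-> {suc x} {suc j} P (s≤s j≤x) (suc y) = dropᵉ-single-> P j≤x y

subst-var-self : ∀ j v → subst j v (var j) ≡ v
subst-var-self j v = if-true (≡⇒≡ᵇ j j refl)

subst-var-< : ∀ {x j} v → x < j → subst j v (var x) ≡ var x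
subst-var-< {x} {j} v x<j = ≡.trans (if-false (<⇒≢ x<j ∘ ≡ᵇ⇒≡ x j)) (if-true (<⇒<ᵇ x<j))

subst-var-> : ∀ {x j} v → j ≤ x → subst j v (var (suc x)) ≡ var x
subst-var-> {x} {j} v j≤x =
  ≡.trans (if-false (>⇒≢ (s≤s j≤x) ∘ ≡ᵇ⇒≡ (suc x) j))
          (if-false (≤⇒≯ (m≤n⇒m≤1+n j≤x) ∘ <ᵇ⇒< (suc x) j))

var-inv : ∀ {Γ x P} (π : Γ ⊢ var x ∶ P) → (Γ ≈ᵉ single x P) × (size π ≡ 0)
var-inv (ax _ _) = ≈ᵉ-refl , refl
var-inv {x = x} (conv Γ≈ P≈ π) with var-inv π
... | Γ≈single , size≡ = ≈ᵉ-trans (≈ᵉ-sym Γ≈) (≈ᵉ-trans Γ≈single (single-cong x P≈)) , size≡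

record AppInversion (Γ : Env) (t u : Term) (Q : Ty) (n : ℕ) : Set where
  constructor mkApp
  field
    Γ₁ Γ₂ : Env
    P : Ty
    function : Γ₁ ⊢ t ∶ mset ((P , Q) ∷ [])
    argument : Γ₂ ⊢ u ∶ P
    env≈ : Γ ≈ᵉ (Γ₁ ⊎ᵉ Γ₂)
    size≡ : n ≡ suc (size function + size argument)

app-inv : ∀ {Γ t u Q} (π : Γ ⊢ app t u ∶ Q) → AppInversion Γ t u Q (size π)
app-inv (appR π₁ π₂) = mkApp _ _ _ π₁ π₂ ≈ᵉ-refl refl
app-inv (conv Γ≈ Q≈ π) with app-inv π
... | mkApp Γ₁ Γ₂ P π₁ π₂ env≈ size≡ =
  mkApp Γ₁ Γ₂ P (conv ≈ᵉ-refl (mset≈ (cons ≈-refl Q≈ nil)) π₁) π₂ (≈ᵉ-trans (≈ᵉ-sym Γ≈) env≈) size≡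

record LamInversion (Γ : Env) (t : Term) (P Q : Ty) (n : ℕ) : Set where
  constructor mkLam
  field
    Γ₀ : Env
    body : (Γ₀ ,, P) ⊢ t ∶ Q
    env≈ : Γ ≈ᵉ Γ₀
    size≡ : n ≡ size body

Prems-[]-inv : ∀ {t Γ} (ps : Prems t Γ []) → (Γ ≈ᵉ emptyEnv) × (sizePs ps ≡ 0)
Prems-[]-inv [] = ≈ᵉ-refl , refl

Prems-[-]-inv : ∀ {t Γ L P Q} (ps : Prems t Γ L) → L ~ ((P , Q) ∷ []) →
                LamInversion Γ t P Q (sizePs ps)
Prems-[-]-inv [] L~[-] with ~-length L~[-]
... | ()
Prems-[-]-inv (_∷_ {Γ} π ps) L~[-] with ~-[-]-inv L~[-] refl
... | _ , _ , refl , P≈ , Q≈ with Prems-[]-inv ps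
...   | Δ≈∅ , size≡0 =
  mkLam Γ (conv (,,-cong ≈ᵉ-refl P≈) Q≈ π) (≈ᵉ-trans (⊎ᵉ-cong ≈ᵉ-refl Δ≈∅) (⊎ᵉ-identityʳ Γ))
        (≡.trans (cong (size π +_) size≡0) (+-identityʳ (size π)))

lam-inv : ∀ {Γ t T P Q} (π : Γ ⊢ lam t ∶ T) → T ≈ mset ((P , Q) ∷ []) → LamInversion Γ t P Q (size π)
lam-inv (lamR ps) (mset≈ L~[-]) = Prems-[-]-inv ps L~[-]
lam-inv (conv Γ≈ T≈ π) T'≈ with lam-inv π (≈-trans T≈ T'≈)
... | mkLam Γ₀ π₀ env≈ size≡ = mkLam Γ₀ π₀ (≈ᵉ-trans (≈ᵉ-sym Γ≈) env≈) size≡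

lam-single : ∀ {Γ t P Q} (π : (Γ ,, P) ⊢ t ∶ Q) →
             Σ[ π' ∈ Γ ⊢ lam t ∶ mset ((P , Q) ∷ []) ] size π' ≡ size π
lam-single {Γ} π = conv (⊎ᵉ-identityʳ Γ) ≈-refl (lamR (π ∷ [])) , +-identityʳ (size π)

value-𝟎 : ∀ {v Δ P} → IsValue v → (ρ : Δ ⊢ v ∶ P) → P ≈ 𝟎 → (Δ ≈ᵉ emptyEnv) × (size ρ ≡ 0)
value-𝟎 _ (ax x _) P≈𝟎 = single-𝟎 x P≈𝟎 , refl
value-𝟎 _ (lamR ps) (mset≈ L~[]) with ~-[]-inv L~[]
... | refl = Prems-[]-inv ps
value-𝟎 iv (conv Δ≈ P≈ ρ) P'≈𝟎 with value-𝟎 iv ρ (≈-trans P≈ P'≈𝟎)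
... | Δ'≈∅ , size≡0 = ≈ᵉ-trans (≈ᵉ-sym Δ≈) Δ'≈∅ , size≡0

record PremsSplit (t : Term) (Δ : Env) (L M : List (Ty × Ty)) (n : ℕ) : Set where
  constructor mkPremsSplit
  field
    Δ₁ Δ₂ : Env
    left : Prems t Δ₁ L
    right : Prems t Δ₂ M
    env≈ : Δ ≈ᵉ (Δ₁ ⊎ᵉ Δ₂)
    size≡ : n ≡ sizePs left + sizePs right

Prems-++-split : ∀ {t Δ} L {M} (ps : Prems t Δ (L ++ M)) → PremsSplit t Δ L M (sizePs ps)
Prems-++-split [] ps = mkPremsSplit emptyEnv _ [] ps (≈ᵉ-sym (⊎ᵉ-identityˡ _)) refl
Prems-++-split (_ ∷ L) (_∷_ {Γ} π ps) with Prems-++-split L ps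
... | mkPremsSplit Δ₁ Δ₂ left right env≈ size≡ =
  mkPremsSplit (Γ ⊎ᵉ Δ₁) Δ₂ (π ∷ left) right
    (≈ᵉ-trans (⊎ᵉ-cong ≈ᵉ-refl env≈) (≈ᵉ-sym (⊎ᵉ-assoc Γ Δ₁ Δ₂)))
    (≡.trans (cong (size π +_) size≡) (≡.sym (+-assoc (size π) _ _)))

Prems-~ : ∀ {t Δ L M} (ps : Prems t Δ L) → L ~ M →
          Σ[ Δ' ∈ Env ] Σ[ ps' ∈ Prems t Δ' M ] (Δ ≈ᵉ Δ') × (sizePs ps ≡ sizePs ps')
Prems-~ [] nil = _ , [] , ≈ᵉ-refl , refl
Prems-~ (π ∷ ps) (cons P≈ Q≈ L~M) with Prems-~ ps L~M
... | _ , ps' , Δ≈ , size≡ =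
  _ , conv (,,-cong ≈ᵉ-refl P≈) Q≈ π ∷ ps' , ⊎ᵉ-cong ≈ᵉ-refl Δ≈ , cong (size π +_) size≡
Prems-~ (_∷_ {Γ₁} π₁ (_∷_ {Γ₂} {Δ} π₂ ps)) swap =
  _ , π₂ ∷ (π₁ ∷ ps) ,
  Env⊎.x∙yz≈y∙xz Γ₁ Γ₂ Δ , ℕ+.x∙yz≈y∙xz (size π₁) (size π₂) (sizePs ps)
Prems-~ ps (trans L~M M~N) with Prems-~ ps L~M
... | _ , ps' , Δ≈ , size≡ with Prems-~ ps' M~N
...   | _ , ps'' , Δ'≈ , size'≡ = _ , ps'' , ≈ᵉ-trans Δ≈ Δ'≈ , ≡.trans size≡ size'≡

-- Only axioms and λ-rules can be split: this is why substitution is restricted to values.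
record ValueSplit (Δ : Env) (v : Term) (A B : Ty) (n : ℕ) : Set where
  constructor mkValueSplit
  field
    Δ₁ Δ₂ : Env
    left : Δ₁ ⊢ v ∶ A
    right : Δ₂ ⊢ v ∶ B
    env≈ : Δ ≈ᵉ (Δ₁ ⊎ᵉ Δ₂)
    size≡ : n ≡ size left + size right

value-split : ∀ {v Δ C} → IsValue v → (ρ : Δ ⊢ v ∶ C) → ∀ A B → C ≈ (A ⊎ᵗ B) → ValueSplit Δ v A B (size ρ)
value-split _ (ax x _) A B C≈ =
  mkValueSplit _ _ (ax x A) (ax x B) (≈ᵉ-trans (single-cong x C≈) (single-⊎ᵗ x A B)) refl
value-split _ (lamR {L = L} ps) (mset la) (mset lb) C≈ with ≡.subst (mset L ≈_) (⊎ᵗ-mset la lb) C≈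
... | mset≈ L~la++lb with Prems-~ ps L~la++lb
...   | _ , ps' , Δ≈ , size≡ with Prems-++-split la ps'
...     | mkPremsSplit Δ₁ Δ₂ left right env≈ size'≡ =
  mkValueSplit Δ₁ Δ₂ (lamR left) (lamR right) (≈ᵉ-trans Δ≈ env≈) (≡.trans size≡ size'≡)
value-split iv (conv Δ≈ C≈ ρ) A B C'≈ with value-split iv ρ A B (≈-trans C≈ C'≈)
... | mkValueSplit Δ₁ Δ₂ left right env≈ size≡ =
  mkValueSplit Δ₁ Δ₂ left right (≈ᵉ-trans (≈ᵉ-sym Δ≈) env≈) size≡

shift-value : ∀ c {v} → IsValue v → IsValue (shift c v)
shift-value c (var-val x) rewrite shift-var c x = var-val _
shift-value c (lam-val t) = lam-val _

mutual
  shift-⊢ : ∀ c {Γ t Q} (π : Γ ⊢ t ∶ Q) → Σ[ π' ∈ shiftᵉ c Γ ⊢ shift c t ∶ Q ] size π' ≡ size π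
  shift-⊢ c (ax x P) rewrite shift-var c x =
    conv (≈ᵉ-sym (shiftᵉ-single c x P)) ≈-refl (ax (punchIn c x) P) , refl
  shift-⊢ c (lamR ps) with shift-Prems c ps
  ... | _ , ps' , Γ'≈ , size≡ = conv Γ'≈ ≈-refl (lamR ps') , size≡
  shift-⊢ c (appR {Γ} {Δ} π₁ π₂) with shift-⊢ c π₁ | shift-⊢ c π₂
  ... | π₁' , size₁≡ | π₂' , size₂≡ =
    conv (≈ᵉ-sym (shiftᵉ-⊎ᵉ c Γ Δ)) ≈-refl (appR π₁' π₂') , cong suc (cong₂ _+_ size₁≡ size₂≡)
  shift-⊢ c (conv Γ≈ Q≈ π) with shift-⊢ c π
  ... | π' , size≡ = conv (shiftᵉ-cong c Γ≈) Q≈ π' , size≡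

  shift-Prems : ∀ c {t Γ L} (ps : Prems t Γ L) →
                Σ[ Γ' ∈ Env ] Σ[ ps' ∈ Prems (shift (suc c) t) Γ' L ]
                  (Γ' ≈ᵉ shiftᵉ c Γ) × (sizePs ps' ≡ sizePs ps)
  shift-Prems c [] = emptyEnv , [] , ≈ᵉ-sym (shiftᵉ-emptyEnv c) , refl
  shift-Prems c (_∷_ {Γ} {Δ} {P} π ps) with shift-⊢ (suc c) π | shift-Prems c ps
  ... | π' , size≡ | Δ' , ps' , Δ'≈ , sizes≡ =
    (shiftᵉ c Γ ⊎ᵉ Δ') , conv (shiftᵉ-,, c Γ P) ≈-refl π' ∷ ps' ,
    ≈ᵉ-trans (⊎ᵉ-cong ≈ᵉ-refl Δ'≈) (≈ᵉ-sym (shiftᵉ-⊎ᵉ c Γ Δ)) , cong₂ _+_ size≡ sizes≡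

ax-≈ᵉ : ∀ {Γ Δ x P} → Γ ≈ᵉ single x P → Δ ≈ᵉ emptyEnv → (Γ ⊎ᵉ Δ) ⊢ var x ∶ P
ax-≈ᵉ {Γ} {x = x} {P} Γ≈ Δ≈∅ =
  conv (≈ᵉ-sym (≈ᵉ-trans (⊎ᵉ-cong Γ≈ Δ≈∅) (⊎ᵉ-identityʳ (single x P)))) ≈-refl (ax x P)

subst-var-⊢ : ∀ j x P {v Δ} → IsValue v → (ρ : Δ ⊢ v ∶ single x P j) →
              Σ[ π ∈ (dropᵉ j (single x P) ⊎ᵉ Δ) ⊢ subst j v (var x) ∶ P ] size π ≡ size ρ
subst-var-⊢ j x P {v} {Δ} iv ρ with <-cmp x j
... | tri≈ _ refl _ rewrite subst-var-self j v =
  conv (≈ᵉ-sym (≈ᵉ-trans (⊎ᵉ-cong (dropᵉ-single-self j P) ≈ᵉ-refl) (⊎ᵉ-identityˡ Δ)))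
       (≈-reflexive (single-self j P)) ρ , refl
... | tri< x<j x≢j _ rewrite subst-var-< v x<j with value-𝟎 iv ρ (≈-reflexive (single-≢ P x≢j))
...   | Δ≈∅ , size≡0 = ax-≈ᵉ (dropᵉ-single-< P x<j) Δ≈∅ , ≡.sym size≡0
subst-var-⊢ j (suc x) P {v} {Δ} iv ρ | tri> _ x≢j (s≤s j≤x) rewrite subst-var-> v j≤x
  with value-𝟎 iv ρ (≈-reflexive (single-≢ P x≢j))
... | Δ≈∅ , size≡0 = ax-≈ᵉ (dropᵉ-single-> P j≤x) Δ≈∅ , ≡.sym size≡0

dropᵉ-⊎ᵉ-interchange : ∀ j Γ₁ Γ₂ {Δ Δ₁ Δ₂} → Δ ≈ᵉ (Δ₁ ⊎ᵉ Δ₂) →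
                       ((dropᵉ j Γ₁ ⊎ᵉ Δ₁) ⊎ᵉ (dropᵉ j Γ₂ ⊎ᵉ Δ₂)) ≈ᵉ (dropᵉ j (Γ₁ ⊎ᵉ Γ₂) ⊎ᵉ Δ)
dropᵉ-⊎ᵉ-interchange j Γ₁ Γ₂ {Δ₁ = Δ₁} {Δ₂} Δ≈ =
  ≈ᵉ-trans (Env⊎.interchange (dropᵉ j Γ₁) Δ₁ (dropᵉ j Γ₂) Δ₂)
           (⊎ᵉ-cong (≈ᵉ-sym (dropᵉ-⊎ᵉ j Γ₁ Γ₂)) (≈ᵉ-sym Δ≈))

dropᵉ-,,-⊎ᵉ-shiftᵉ : ∀ j Γ Δ P → (dropᵉ (suc j) (Γ ,, P) ⊎ᵉ shiftᵉ 0 Δ) ≈ᵉ ((dropᵉ j Γ ⊎ᵉ Δ) ,, P)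
dropᵉ-,,-⊎ᵉ-shiftᵉ j Γ Δ P zero = ⊎ᵗ-identityʳ P
dropᵉ-,,-⊎ᵉ-shiftᵉ j Γ Δ P (suc y) = ≈-refl

m+suc[n+o]≡suc[m+n]+o : ∀ m n o → m + suc (n + o) ≡ suc (m + n) + o
m+suc[n+o]≡suc[m+n]+o = solve-∀

suc[k+m+n]≡k+suc[m+n] : ∀ k m n → suc (k + m + n) ≡ k + suc (m + n)
suc[k+m+n]≡k+suc[m+n] = solve-∀

suc[m+[k+n]]≡k+suc[m+n] : ∀ k m n → suc (m + (k + n)) ≡ k + suc (m + n)
suc[m+[k+n]]≡k+suc[m+n] = solve-∀

+-interchange-≡ : ∀ a b c d {m n r} → m ≡ a + b → n ≡ c + d → r ≡ b + d → m + n ≡ (a + c) + r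
+-interchange-≡ a b c d refl refl refl = ℕ+.interchange a b c d

mutual
  subst-⊢ : ∀ j {Γ t Q} (π : Γ ⊢ t ∶ Q) {v Δ} → IsValue v → (ρ : Δ ⊢ v ∶ Γ j) →
            Σ[ π' ∈ (dropᵉ j Γ ⊎ᵉ Δ) ⊢ subst j v t ∶ Q ] size π' ≡ size π + size ρ
  subst-⊢ j (ax x P) iv ρ = subst-var-⊢ j x P iv ρ
  subst-⊢ j (lamR ps) iv ρ with subst-Prems j ps iv ρ
  ... | _ , ps' , Γ'≈ , size≡ = conv Γ'≈ ≈-refl (lamR ps') , size≡
  subst-⊢ j (appR {Γ₁} {Γ₂} π₁ π₂) iv ρ with value-split iv ρ (Γ₁ j) (Γ₂ j) ≈-refl
  ... | mkValueSplit _ _ ρ₁ ρ₂ Δ≈ sizeρ≡ with subst-⊢ j π₁ iv ρ₁ | subst-⊢ j π₂ iv ρ₂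
  ...   | π₁' , size₁≡ | π₂' , size₂≡ =
    conv (dropᵉ-⊎ᵉ-interchange j Γ₁ Γ₂ Δ≈) ≈-refl (appR π₁' π₂') ,
    cong suc (+-interchange-≡ (size π₁) (size ρ₁) (size π₂) (size ρ₂) size₁≡ size₂≡ sizeρ≡)
  subst-⊢ j (conv Γ≈ Q≈ π) iv ρ with subst-⊢ j π iv (conv ≈ᵉ-refl (≈-sym (Γ≈ j)) ρ)
  ... | π' , size≡ = conv (⊎ᵉ-cong (dropᵉ-cong j Γ≈) ≈ᵉ-refl) Q≈ π' , size≡

  subst-Prems : ∀ j {t Γ L} (ps : Prems t Γ L) {v Δ} → IsValue v → (ρ : Δ ⊢ v ∶ Γ j) →
                Σ[ Γ' ∈ Env ] Σ[ ps' ∈ Prems (subst (suc j) (shift 0 v) t) Γ' L ]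
                  (Γ' ≈ᵉ (dropᵉ j Γ ⊎ᵉ Δ)) × (sizePs ps' ≡ sizePs ps + size ρ)
  subst-Prems j [] iv ρ with value-𝟎 iv ρ ≈-refl
  ... | Δ≈∅ , size≡0 =
    emptyEnv , [] , ≈ᵉ-sym (≈ᵉ-trans (⊎ᵉ-cong (dropᵉ-emptyEnv j) Δ≈∅) (⊎ᵉ-identityˡ emptyEnv)) ,
    ≡.sym size≡0
  subst-Prems j (_∷_ {Γ₀} {Γs} {P} π ps) iv ρ with value-split iv ρ (Γ₀ j) (Γs j) ≈-refl
  ... | mkValueSplit Δ₁ _ ρ₁ ρ₂ Δ≈ sizeρ≡ with shift-⊢ 0 ρ₁
  ...   | ρ₁' , sizeρ₁'≡ with subst-⊢ (suc j) π (shift-value 0 iv) ρ₁' | subst-Prems j ps iv ρ₂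
  ...     | π' , size≡ | Γ' , ps' , Γ'≈ , sizes≡ =
    ((dropᵉ j Γ₀ ⊎ᵉ Δ₁) ⊎ᵉ Γ') , conv (dropᵉ-,,-⊎ᵉ-shiftᵉ j Γ₀ Δ₁ P) ≈-refl π' ∷ ps' ,
    ≈ᵉ-trans (⊎ᵉ-cong ≈ᵉ-refl Γ'≈) (dropᵉ-⊎ᵉ-interchange j Γ₀ Γs Δ≈) ,
    +-interchange-≡ (size π) (size ρ₁) (sizePs ps) (size ρ₂)
                    (≡.trans size≡ (cong (size π +_) sizeρ₁'≡)) sizes≡ sizeρ≡

record RedexInversion (Γ : Env) (t u : Term) (Q : Ty) (n : ℕ) : Set where
  constructor mkRedex
  field
    Γ₀ Δ : Env
    P : Ty
    body : (Γ₀ ,, P) ⊢ t ∶ Q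
    argument : Δ ⊢ u ∶ P
    env≈ : Γ ≈ᵉ (Γ₀ ⊎ᵉ Δ)
    size≡ : n ≡ suc (size body + size argument)

redex-inv : ∀ {Γ t u Q} (π : Γ ⊢ app (lam t) u ∶ Q) → RedexInversion Γ t u Q (size π)
redex-inv π with app-inv π
... | mkApp Γ₁ Γ₂ P πl πu Γ≈ size≡ with lam-inv πl ≈-refl
...   | mkLam Γ₀ π₀ Γ₁≈ sizel≡ =
  mkRedex Γ₀ Γ₂ P π₀ πu (≈ᵉ-trans Γ≈ (⊎ᵉ-cong Γ₁≈ ≈ᵉ-refl))
          (≡.trans size≡ (cong (λ n → suc (n + size πu)) sizel≡))

redex-⊢ : ∀ {Γ Γ₀ Δ t u P Q} → Γ ≈ᵉ (Γ₀ ⊎ᵉ Δ) → (π₀ : (Γ₀ ,, P) ⊢ t ∶ Q) (πu : Δ ⊢ u ∶ P) →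
          Σ[ π ∈ Γ ⊢ app (lam t) u ∶ Q ] size π ≡ suc (size π₀ + size πu)
redex-⊢ Γ≈ π₀ πu with lam-single π₀
... | πl , sizel≡ = conv (≈ᵉ-sym Γ≈) ≈-refl (appR πl πu) , cong (λ n → suc (n + size πu)) sizel≡

,,-⊎ᵉ-shiftᵉʳ : ∀ Γ Δ P → ((Γ ,, P) ⊎ᵉ shiftᵉ 0 Δ) ≈ᵉ ((Γ ⊎ᵉ Δ) ,, P)
,,-⊎ᵉ-shiftᵉʳ Γ Δ P zero = ⊎ᵗ-identityʳ P
,,-⊎ᵉ-shiftᵉʳ Γ Δ P (suc y) = ≈-refl

,,-⊎ᵉ-shiftᵉˡ : ∀ Γ Δ P → (shiftᵉ 0 Γ ⊎ᵉ (Δ ,, P)) ≈ᵉ ((Γ ⊎ᵉ Δ) ,, P)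
,,-⊎ᵉ-shiftᵉˡ Γ Δ P zero = ⊎ᵗ-identityˡ P
,,-⊎ᵉ-shiftᵉˡ Γ Δ P (suc y) = ≈-refl

βv-⊢ : ∀ {Γ t v Q} → IsValue v → (π : Γ ⊢ app (lam t) v ∶ Q) →
       Σ[ π' ∈ Γ ⊢ t [ v ] ∶ Q ] size π ≡ suc (size π')
βv-⊢ iv π with redex-inv π
... | mkRedex Γ₀ Δ P π₀ πv Γ≈ size≡ with subst-⊢ 0 π₀ iv πv
...   | π' , size'≡ = conv (≈ᵉ-sym Γ≈) ≈-refl π' , ≡.trans size≡ (cong suc (≡.sym size'≡))

σ₁-⊢ : ∀ {Γ t u s Q} (π : Γ ⊢ app (app (lam t) u) s ∶ Q) →
       Σ[ π' ∈ Γ ⊢ app (lam (app t (shift 0 s))) u ∶ Q ] size π ≡ size π'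
σ₁-⊢ π with app-inv π
... | mkApp Γ₁ Γ₂ R πr πs Γ≈ size≡ with redex-inv πr
...   | mkRedex Γ₀ Δ P π₀ πu Γ₁≈ sizer≡ with shift-⊢ 0 πs
...     | πs' , sizes'≡
  with redex-⊢ (≈ᵉ-trans Γ≈ (≈ᵉ-trans (⊎ᵉ-cong Γ₁≈ ≈ᵉ-refl) (Env⊎.xy∙z≈xz∙y Γ₀ Δ Γ₂)))
               (conv (,,-⊎ᵉ-shiftᵉʳ Γ₀ Γ₂ P) ≈-refl (appR π₀ πs')) πu
...       | π' , size'≡ = π' , (begin
  size π                                    ≡⟨ size≡ ⟩
  suc (size πr + size πs)                   ≡⟨ cong (λ n → suc (n + size πs)) sizer≡ ⟩
  suc (suc (size π₀ + size πu) + size πs)   ≡⟨ cong (suc ∘ suc) (ℕ+.xy∙z≈xz∙y (size π₀) (size πu) (size πs)) ⟩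
  suc (suc (size π₀ + size πs) + size πu)   ≡⟨ cong (λ n → suc (suc (size π₀ + n) + size πu)) sizes'≡ ⟨
  suc (suc (size π₀ + size πs') + size πu)  ≡⟨ size'≡ ⟨
  size π'                                   ∎)

σ₃-⊢ : ∀ {Γ v s u Q} (π : Γ ⊢ app v (app (lam s) u) ∶ Q) →
       Σ[ π' ∈ Γ ⊢ app (lam (app (shift 0 v) s)) u ∶ Q ] size π ≡ size π'
σ₃-⊢ π with app-inv π
... | mkApp Γ₁ Γ₂ R πv πr Γ≈ size≡ with redex-inv πr
...   | mkRedex Γ₀ Δ P π₀ πu Γ₂≈ sizer≡ with shift-⊢ 0 πv
...     | πv' , sizev'≡
  with redex-⊢ (≈ᵉ-trans Γ≈ (≈ᵉ-trans (⊎ᵉ-cong ≈ᵉ-refl Γ₂≈) (≈ᵉ-sym (⊎ᵉ-assoc Γ₁ Γ₀ Δ))))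
               (conv (,,-⊎ᵉ-shiftᵉˡ Γ₁ Γ₀ P) ≈-refl (appR πv' π₀)) πu
...       | π' , size'≡ = π' , (begin
  size π                                    ≡⟨ size≡ ⟩
  suc (size πv + size πr)                   ≡⟨ cong (λ n → suc (size πv + n)) sizer≡ ⟩
  suc (size πv + suc (size π₀ + size πu))   ≡⟨ cong suc (m+suc[n+o]≡suc[m+n]+o (size πv) (size π₀) (size πu)) ⟩
  suc (suc (size πv + size π₀) + size πu)   ≡⟨ cong (λ n → suc (suc (n + size π₀) + size πu)) sizev'≡ ⟨
  suc (suc (size πv' + size π₀) + size πu)  ≡⟨ size'≡ ⟨
  size π'                                   ∎)

root-⊢ : ∀ {r t u} → Root r t u → ∀ {Γ Q} (π : Γ ⊢ t ∶ Q) →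
         Σ[ π' ∈ Γ ⊢ u ∶ Q ] size π ≡ isβv r + size π'
root-⊢ (root-βv _ _ iv) π = βv-⊢ iv π
root-⊢ (root-σ₁ _ _ _) π = σ₁-⊢ π
root-⊢ (root-σ₃ _ _ _ _) π = σ₃-⊢ π

step-⊢ : ∀ {r t u} → Step r t u → ∀ {Γ Q} (π : Γ ⊢ t ∶ Q) →
         Σ[ π' ∈ Γ ⊢ u ∶ Q ] size π ≡ isβv r + size π'
step-⊢ (hole root) π = root-⊢ root π
step-⊢ {r} (under u st) π with redex-inv π
... | mkRedex Γ₀ Δ P π₀ πu Γ≈ size≡ with step-⊢ st π₀
...   | π₀' , size₀≡ with redex-⊢ Γ≈ π₀' πu
...     | π' , size'≡ = π' , (begin
  size π                               ≡⟨ size≡ ⟩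
  suc (size π₀ + size πu)              ≡⟨ cong (λ n → suc (n + size πu)) size₀≡ ⟩
  suc (isβv r + size π₀' + size πu)    ≡⟨ suc[k+m+n]≡k+suc[m+n] (isβv r) (size π₀') (size πu) ⟩
  isβv r + suc (size π₀' + size πu)    ≡⟨ cong (isβv r +_) size'≡ ⟨
  isβv r + size π'                     ∎)
step-⊢ {r} (appL _ st) π with app-inv π
... | mkApp Γ₁ Γ₂ P π₁ π₂ Γ≈ size≡ with step-⊢ st π₁
...   | π₁' , size₁≡ = conv (≈ᵉ-sym Γ≈) ≈-refl (appR π₁' π₂) , (begin
  size π                               ≡⟨ size≡ ⟩
  suc (size π₁ + size π₂)              ≡⟨ cong (λ n → suc (n + size π₂)) size₁≡ ⟩
  suc (isβv r + size π₁' + size π₂)    ≡⟨ suc[k+m+n]≡k+suc[m+n] (isβv r) (size π₁') (size π₂) ⟩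
  isβv r + suc (size π₁' + size π₂)    ∎)
step-⊢ {r} (appR _ st) π with app-inv π
... | mkApp Γ₁ Γ₂ P π₁ π₂ Γ≈ size≡ with step-⊢ st π₂
...   | π₂' , size₂≡ = conv (≈ᵉ-sym Γ≈) ≈-refl (appR π₁ π₂') , (begin
  size π                               ≡⟨ size≡ ⟩
  suc (size π₁ + size π₂)              ≡⟨ cong (λ n → suc (size π₁ + n)) size₂≡ ⟩
  suc (size π₁ + (isβv r + size π₂'))  ≡⟨ suc[m+[k+n]]≡k+suc[m+n] (isβv r) (size π₁) (size π₂') ⟩
  isβv r + suc (size π₁ + size π₂')    ∎)

Normal-appL : ∀ {t u} → Normal (app t u) → Normal t
Normal-appL nf t' (r , st) = nf _ (r , appL _ st)

Normal-appR : ∀ {t u} → Normal (app t u) → Normal u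
Normal-appR nf u' (r , st) = nf _ (r , appR _ st)

app-inv-∅ : ∀ {Γ t u Q} → Γ ⊢ app t u ∶ Q → Γ ≈ᵉ emptyEnv →
            Σ[ P ∈ Ty ] (emptyEnv ⊢ t ∶ mset ((P , Q) ∷ [])) × (emptyEnv ⊢ u ∶ P)
app-inv-∅ π Γ≈∅ with app-inv π
... | mkApp Γ₁ Γ₂ P π₁ π₂ Γ≈ _ with ⊎ᵉ-conical Γ₁ Γ₂ (≈ᵉ-trans (≈ᵉ-sym Γ≈) Γ≈∅)
...   | Γ₁≈∅ , Γ₂≈∅ = P , conv Γ₁≈∅ ≈-refl π₁ , conv Γ₂≈∅ ≈-refl π₂

var-∅-𝟎 : ∀ {x P} → emptyEnv ⊢ var x ∶ P → P ≈ 𝟎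
var-∅-𝟎 {x} {P} π = ≈-sym (≈-trans (proj₁ (var-inv π) x) (≈-reflexive (single-self x P)))

app-not-value : ∀ {t u} → ¬ IsValue (app t u)
app-not-value ()

normal-∅-value : ∀ {n P} → Normal n → emptyEnv ⊢ n ∶ P → IsValue n
normal-∅-value {var x} _ _ = var-val x
normal-∅-value {lam t} _ _ = lam-val t
normal-∅-value {app (var _) _} _ π =
  let _ , π₁ , _ = app-inv-∅ π ≈ᵉ-refl
  in ⊥-elim (1+n≢0 (card-≈ (var-∅-𝟎 π₁)))
normal-∅-value {app (app _ _) _} nf π =
  let _ , π₁ , _ = app-inv-∅ π ≈ᵉ-refl
  in ⊥-elim (app-not-value (normal-∅-value (Normal-appL nf) π₁))
normal-∅-value {app (lam s) u} nf π =
  let _ , _ , π₂ = app-inv-∅ π ≈ᵉ-refl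
  in ⊥-elim (nf _ (βv , hole (root-βv s u (normal-∅-value (Normal-appR nf) π₂))))

normal-∅-𝟎-size : ∀ {n} → Normal n → (π : emptyEnv ⊢ n ∶ 𝟎) → size π ≡ 0
normal-∅-𝟎-size nf π = proj₂ (value-𝟎 (normal-∅-value nf π) π ≈-refl)

βvSteps≡size : ∀ {t n} (d : Seq t n) → Normal n → (π : emptyEnv ⊢ t ∶ 𝟎) → βvSteps d ≡ size π
βvSteps≡size (done _) nf π = ≡.sym (normal-∅-𝟎-size nf π)
βvSteps≡size (next r st d) nf π with step-⊢ st π
... | π' , size≡ = ≡.trans (cong (isβv r +_) (βvSteps≡size d nf π')) (≡.sym size≡)

-- The hypothesis that t reduces to a value is not needed: typability with type 𝟎 in the
-- empty environment already forces the normal form to be a value.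
mainTheorem3 : ∀ (t v : Term) → IsValue v → Seq t v →
    ∀ (π : emptyEnv ⊢ t ∶ 𝟎) (n : Term) (d : Seq t n) → Normal n →
    βvSteps d ≡ size π
mainTheorem3 _ _ _ _ π _ d nf = βvSteps≡size d nf π
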